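{- Let $V_1,V_2,V_3$ be disjoint sets and let $(\mathcal{Z},\mathcal{E})$ be a $2$-partition on $V_1\cup V_2\cup V_3$ with $\mathcal{Z}\prec\{V_1,V_2,V_3\}$. Let $\mathcal{G}$ be a partition of $V_1\times V_2$ (viewed as a partition of the edge set of the complete bipartite graph on $(V_1,V_2)$ into bipartite graphs) with $\mathcal{E}_3\prec_\delta\mathcal{G}$. If $(\mathcal{Z},\mathcal{E})$ is $\langle\delta\rangle$-good, then $\mathcal{Z}_1\cup\mathcal{Z}_2$ is a $\langle 3\delta\rangle$-regular partition of some $G\in\mathcal{G}$.
   Context: A $2$-partition $(\mathcal{Z},\mathcal{E})$ on $V$: a partition $\mathcal{Z}$ of $V$ and a family $\mathcal{E}$ of mutually edge-disjoint bipartite graphs, each having as vertex classes two distinct members of $\mathcal{Z}$, such that for all $Z\ne Z'\in\mathcal{Z}$ the complete bipartite graph $Z\times Z'$ is a union of graphs from $\mathcal{E}$. $\mathcal{Z}\prec\{V_1,V_2,V_3\}$ means each part of $\mathcal{Z}$ lies in some $V_i$; then $\mathcal{Z}_i=\{Z\in\mathcal{Z}:Z\subseteq V_i\}$, and $\mathcal{E}_3=\{E\in\mathcal{E}:E\subseteq V_1\times V_2\}$ (a partition of $V_1\times V_2$). For a bipartite graph $G$ on $(A,B)$, $d_G(A',B')=e_G(A',B')/(|A'||B'|)$; $G$ is $\langle\delta\rangle$-regular if all $A'\subseteq A$, $B'\subseteq B$ with $|A'|\ge\delta|A|$, $|B'|\ge\delta|B|$ satisfy $d_G(A',B')\ge\frac12d_G(A,B)$.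 The $2$-partition is $\langle\delta\rangle$-good if every graph in $\mathcal{E}$ is $\langle\delta\rangle$-regular. A vertex partition $\mathcal{P}$ of a graph $G$ is a $\langle\delta\rangle$-regular partition of $G$ if one can add/remove at most $\delta e(G)$ edges of $G$ so that for all $A\ne B\in\mathcal{P}$ the induced bipartite graph on $(A,B)$ is $\langle\delta\rangle$-regular. Approximate refinement: $S\subseteq_\beta T$ if $|S\setminus T|<\beta|S|$; $S\in_\beta\mathcal{P}$ if $S\subseteq_\beta P$ for some $P\in\mathcal{P}$; for partitions of a common $n$-element set, $\mathcal{Q}\prec_\beta\mathcal{P}$ if $\sum_{Q\in\mathcal{Q},Q\notin_\beta\mathcal{P}}|Q|\le\beta n$.
   Formalization: The parameter δ takes values in the rationals. -}

module Defs where

open import Data.Nat as ℕ using (ℕ; zero; suc)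
open import Data.Fin using (Fin; zero; suc)
open import Data.Fin.Properties using (_≟_; _<?_)
open import Data.Bool using (Bool; true; false; _∧_; _∨_; not; _xor_; if_then_else_)
open import Data.Integer using (+_)
open import Data.Rational using (ℚ; _/_; _≤_; _≤ᵇ_; _*_)
open import Data.Product using (Σ; ∃; _×_; _,_)
open import Relation.Binary.PropositionalEquality using (_≡_; _≢_)
open import Relation.Nullary using (does)

sumF : ∀ {n} → (Fin n → ℕ) → ℕ
sumF {zero}  f = 0
sumF {suc n} f = f zero ℕ.+ sumF (λ i → f (suc i))

anyF : ∀ {n} → (Fin n → Bool) → Bool
anyF {zero}  p = false
anyF {suc n} p = p zero ∨ anyF (λ i → p (suc i))

count : ∀ {n} → (Fin n → Bool) → ℕ
count p = sumF (λ i → if p i then 1 else 0)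

count2 : ∀ {n} → (Fin n → Fin n → Bool) → ℕ
count2 p = sumF (λ x → count (p x))

⟦_⟧ : ℕ → ℚ
⟦ m ⟧ = + m / 1

_==_ : ∀ {k} → Fin k → Fin k → Bool
a == b = does (a ≟ b)

Subset : ℕ → Set
Subset n = Fin n → Bool

_⊆_ : ∀ {n} → Subset n → Subset n → Set
S ⊆ T = ∀ x → S x ≡ true → T x ≡ true

-- Bipartite graphs and ⟨δ⟩-regularity.
-- A bipartite graph on (A,B) is given by an oriented edge relation
-- E x y (x on the A-side, y on the B-side); only pairs in A × B count.

eG : ∀ {n} → (Fin n → Fin n → Bool) → Subset n → Subset n → ℕ
eG E A B = count2 (λ x y → A x ∧ B y ∧ E x y)

-- ⟨δ⟩-regular: every A' ⊆ A, B' ⊆ B with |A'| ≥ δ|A|, |B'| ≥ δ|B| has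
-- d(A',B') ≥ ½ d(A,B), i.e.  e(A',B')/(|A'||B'|) ≥ e(A,B)/(2|A||B|),
-- written with denominators cleared.
Regular : ∀ {n} → ℚ → (Fin n → Fin n → Bool) → Subset n → Subset n → Set
Regular {n} δ E A B =
  ∀ (A' B' : Subset n) → A' ⊆ A → B' ⊆ B →
  δ * ⟦ count A ⟧ ≤ ⟦ count A' ⟧ → δ * ⟦ count B ⟧ ≤ ⟦ count B' ⟧ →
  eG E A B ℕ.* count A' ℕ.* count B' ℕ.≤ 2 ℕ.* eG E A' B' ℕ.* count A ℕ.* count B

-- G is a symmetric Bool relation; its edges are the pairs {x,y}, x < y.
-- The partition has parts  part c  for the indices c with  inP c.
-- "Add/remove at most δ e(G) edges": a graph G' on W whose edge set
-- differs from that of G in at most δ e(G) edges.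

edgesOf : ∀ {n} → (Fin n → Fin n → Bool) → ℕ
edgesOf G = count2 (λ x y → does (x <? y) ∧ G x y)

diffEdges : ∀ {n} → (Fin n → Fin n → Bool) → (Fin n → Fin n → Bool) → ℕ
diffEdges G G' = count2 (λ x y → does (x <? y) ∧ (G x y xor G' x y))

RegularPartition : ∀ {n k} → ℚ → (W : Subset n) → (G : Fin n → Fin n → Bool) →
                   (part : Fin k → Subset n) → (inP : Fin k → Set) → Set
RegularPartition {n} {k} δ W G part inP =
  Σ (Fin n → Fin n → Bool) λ G' →
    (∀ x y → G' x y ≡ G' y x) ×
    (∀ x y → G' x y ≡ true → (W x ≡ true) × (W y ≡ true)) ×
    (⟦ diffEdges G G' ⟧ ≤ δ * ⟦ edgesOf G ⟧) ×
    (∀ c c' → inP c → inP c' → c ≢ c' → Regular δ G' (part c) (part c'))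

-- The sets V₁,V₂,V₃: a labelling vp : Fin n → Fin 3 of the ground set
-- V = V₁ ∪ V₂ ∪ V₃ = Fin n (disjointness is automatic).

v₁ v₂ v₃ : Fin 3
v₁ = zero
v₂ = suc zero
v₃ = suc (suc zero)

-- A 2-partition (𝒵, ℰ) on Fin n.
-- 𝒵: parts Z⁻¹(c), c : Fin k, all nonempty.
-- ℰ: graphs e : Fin m with vertex classes (cA e, cB e), distinct members
-- of 𝒵; edge e x y = true means {x,y} is an edge of graph e with
-- x ∈ cA e, y ∈ cB e.

record TwoPartition (n : ℕ) : Set where
  field
    k       : ℕ
    Z       : Fin n → Fin k
    Z-onto  : ∀ c → ∃ λ x → Z x ≡ c
    m       : ℕ
    cA cB   : Fin m → Fin k
    cA≢cB   : ∀ e → cA e ≢ cB e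
    edge    : Fin m → Fin n → Fin n → Bool
    edge-in : ∀ e x y → edge e x y ≡ true → (Z x ≡ cA e) × (Z y ≡ cB e)
    cover   : ∀ x y → Z x ≢ Z y → ∃ λ e → (edge e x y ∨ edge e y x) ≡ true
    disjoint : ∀ e e' x y → (edge e x y ∨ edge e y x) ≡ true →
               (edge e' x y ∨ edge e' y x) ≡ true → e ≡ e'

  classA classB : Fin m → Subset n
  classA e x = Z x == cA e
  classB e x = Z x == cB e

  Good : ℚ → Set
  Good δ = ∀ e → Regular δ (edge e) (classA e) (classB e)

module _ {n : ℕ} (vp : Fin n → Fin 3) (P : TwoPartition n) where
  open TwoPartition P

  Refines : Set
  Refines = ∀ x y → Z x ≡ Z y → vp x ≡ vp y

  -- the part with index c lies in V_i (parts are nonempty)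
  inCls : Fin k → Fin 3 → Bool
  inCls c i = anyF (λ x → (Z x == c) ∧ (vp x == i))

  V₁×V₂ : Fin n → Fin n → Bool
  V₁×V₂ x y = (vp x == v₁) ∧ (vp y == v₂)

  isE₃ : Fin m → Bool
  isE₃ e = (inCls (cA e) v₁ ∧ inCls (cB e) v₂) ∨ (inCls (cA e) v₂ ∧ inCls (cB e) v₁)

  Qset : Fin m → Fin n → Fin n → Bool
  Qset e x y = V₁×V₂ x y ∧ (edge e x y ∨ edge e y x)

  module _ {p : ℕ} (Gset : Fin p → Fin n → Fin n → Bool) where
    subβ : ℚ → Fin m → Fin p → Bool
    subβ β e j = not ((β * ⟦ count2 (Qset e) ⟧) ≤ᵇ
                      ⟦ count2 (λ x y → Qset e x y ∧ not (Gset j x y)) ⟧)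

    inβ : ℚ → Fin m → Bool
    inβ β e = anyF (subβ β e)

    RefinesApprox : ℚ → Set
    RefinesApprox β =
      ⟦ sumF (λ e → if isE₃ e ∧ not (inβ β e) then count2 (Qset e) else 0) ⟧
        ≤ β * ⟦ count2 V₁×V₂ ⟧

-- Assign to each graph e ∈ ℰ₃ some class G_j of 𝒢 with e ⊆_δ G_j, if there is one, and let G′_j be
-- the union of the graphs assigned to G_j.  Density bounds of the form e(A,B)|A′||B′| ≤ 2e(A′,B′)|A||B|
-- add up over edge-disjoint graphs, so G′_j inherits ⟨δ⟩-regularity between any two parts from the
-- graphs of ℰ.  An assigned graph e ⊆_δ G_j changes fewer than 2δ|e| edges of the G_i, an unassigned
-- one at most |e|, and ℰ₃ ≺_δ 𝒢 bounds the unassigned ones by δ|V₁ × V₂|; so G′_j and G_j differ in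
-- at most 3δ|V₁ × V₂| = 3δ Σ_j e(G_j) edges in total, and averaging over j finds a good class.

module Submission where

open import Defs
open import Data.Nat as ℕ using (ℕ; zero; suc; z≤n; s≤s)
import Data.Nat.Properties as ℕ
open import Data.Fin using (Fin; zero; suc)
import Data.Fin.Properties as Fin
import Data.Bool.Properties as Bool
open import Data.Bool using (Bool; true; false; not; _∧_; _∨_; _xor_; if_then_else_)
import Data.Integer as ℤ
import Data.Integer.Properties as ℤ
open import Data.Rational as ℚ using (ℚ; mkℚ; 0ℚ; _+_; _*_; _≤_; _<_)
import Data.Rational.Properties as ℚ
import Data.Rational.Unnormalised as ℚᵘ
import Data.Rational.Unnormalised.Properties as ℚᵘ
import Data.Nat.Coprimality as Coprime
open import Data.Product using (∃; _×_; _,_; proj₁; proj₂)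
open import Data.Sum using (_⊎_; inj₁; inj₂)
open import Data.Maybe using (Maybe; just; nothing)
open import Data.Empty using (⊥-elim)
open import Relation.Nullary using (Dec; yes; no; does)
open import Relation.Nullary.Decidable using (dec-true; dec-false; _×-dec_)
open import Relation.Binary using (tri<; tri≈; tri>)
open import Relation.Binary.PropositionalEquality
open import Function using (_∘_; flip; Equivalence)
open import Data.Nat.Tactic.RingSolver using (solve-∀)
import Algebra.Properties.Semiring.Sum as SemiringSum
open import Algebra.Bundles using (Ring)

module ℕΣ = SemiringSum ℕ.+-*-semiring
module ℚΣ = SemiringSum (Ring.semiring ℚ.+-*-ring)

𝟙 : Bool → ℕ
𝟙 b = if b then 1 else 0

∧-true : ∀ {a b} → a ∧ b ≡ true → (a ≡ true) × (b ≡ true)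
∧-true {true} {true} _ = refl , refl

∧-cong-true : ∀ {a b c} → (a ≡ true → b ≡ c) → a ∧ b ≡ a ∧ c
∧-cong-true {true}  b≡c = b≡c refl
∧-cong-true {false} _   = refl

true≢false : true ≢ false
true≢false ()

==-sound : ∀ {k} {a b : Fin k} → (a == b) ≡ true → a ≡ b
==-sound {a = a} {b} a==b with a Fin.≟ b | a==b
... | yes a≡b | _ = a≡b
... | no  _   | ()

==-refl : ∀ {k} (a : Fin k) → (a == a) ≡ true
==-refl a = dec-true (a Fin.≟ a) refl

==-≢ : ∀ {k} {a b : Fin k} → a ≢ b → (a == b) ≡ false
==-≢ {a = a} {b} = dec-false (a Fin.≟ b)

sumF≡sum : ∀ {k} (f : Fin k → ℕ) → sumF f ≡ ℕΣ.sum f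
sumF≡sum {zero}  f = refl
sumF≡sum {suc k} f = cong (f zero ℕ.+_) (sumF≡sum (f ∘ suc))

sumF-via-sum : ∀ {k} {f g : Fin k → ℕ} → ℕΣ.sum f ≡ ℕΣ.sum g → sumF f ≡ sumF g
sumF-via-sum {f = f} {g} eq = trans (sumF≡sum f) (trans eq (sym (sumF≡sum g)))

sumF-cong : ∀ {k} {f g : Fin k → ℕ} → (∀ i → f i ≡ g i) → sumF f ≡ sumF g
sumF-cong {f = f} {g} h = sumF-via-sum {f = f} {g} (ℕΣ.sum-cong-≗ h)

sumF-distrib-+ : ∀ {k} (f g : Fin k → ℕ) → sumF (λ i → f i ℕ.+ g i) ≡ sumF f ℕ.+ sumF g
sumF-distrib-+ f g = trans (sumF≡sum (λ i → f i ℕ.+ g i))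
  (trans (ℕΣ.∑-distrib-+ f g) (sym (cong₂ ℕ._+_ (sumF≡sum f) (sumF≡sum g))))

sumF-distribˡ-* : ∀ {k} (c : ℕ) (f : Fin k → ℕ) → sumF (λ i → c ℕ.* f i) ≡ c ℕ.* sumF f
sumF-distribˡ-* c f = trans (sumF≡sum (λ i → c ℕ.* f i))
  (trans (sym (ℕΣ.*-distribˡ-sum c f)) (cong (c ℕ.*_) (sym (sumF≡sum f))))

sumF-comm : ∀ {a b} (F : Fin a → Fin b → ℕ) →
            sumF (λ i → sumF (F i)) ≡ sumF (λ j → sumF (λ i → F i j))
sumF-comm F = begin
  sumF (λ i → sumF (F i))                  ≡⟨ sumF-cong (λ i → sumF≡sum (F i)) ⟩
  sumF (λ i → ℕΣ.sum (F i))                ≡⟨ sumF≡sum (λ i → ℕΣ.sum (F i)) ⟩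
  ℕΣ.sum (λ i → ℕΣ.sum (F i))              ≡⟨ ℕΣ.∑-comm F ⟩
  ℕΣ.sum (λ j → ℕΣ.sum (λ i → F i j))      ≡⟨ sumF≡sum (λ j → ℕΣ.sum (λ i → F i j)) ⟨
  sumF (λ j → ℕΣ.sum (λ i → F i j))        ≡⟨ sumF-cong (λ j → sumF≡sum (λ i → F i j)) ⟨
  sumF (λ j → sumF (λ i → F i j))          ∎
  where open ≡-Reasoning

sumF-zero : ∀ {k} {f : Fin k → ℕ} → (∀ i → f i ≡ 0) → sumF f ≡ 0
sumF-zero {zero}  h = refl
sumF-zero {suc k} h rewrite h zero = sumF-zero (h ∘ suc)

sumF-single : ∀ {k} (f : Fin k → ℕ) (i₀ : Fin k) → (∀ i → i ≢ i₀ → f i ≡ 0) → sumF f ≡ f i₀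
sumF-single f zero h = trans (cong (f zero ℕ.+_) (sumF-zero (λ i → h (suc i) λ ()))) (ℕ.+-identityʳ _)
sumF-single f (suc i₀) h rewrite h zero (λ ()) =
  sumF-single (f ∘ suc) i₀ (λ i i≢i₀ → h (suc i) (i≢i₀ ∘ Fin.suc-injective))

sumF-mono : ∀ {k} {f g : Fin k → ℕ} → (∀ i → f i ℕ.≤ g i) → sumF f ℕ.≤ sumF g
sumF-mono {zero}  h = z≤n
sumF-mono {suc k} h = ℕ.+-mono-≤ (h zero) (sumF-mono (h ∘ suc))

term≤sumF : ∀ {k} (f : Fin k → ℕ) (i : Fin k) → f i ℕ.≤ sumF f
term≤sumF f zero    = ℕ.m≤m+n _ _
term≤sumF f (suc i) = ℕ.≤-trans (term≤sumF (f ∘ suc) i) (ℕ.m≤n+m _ (f zero))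

sumF-pos⇒term-pos : ∀ {k} (f : Fin k → ℕ) → 0 ℕ.< sumF f → ∃ λ i → 0 ℕ.< f i
sumF-pos⇒term-pos {suc k} f h with f zero in eq
... | suc _ = zero , subst (0 ℕ.<_) (sym eq) (s≤s z≤n)
... | zero with sumF-pos⇒term-pos (f ∘ suc) h
...   | i , fi>0 = suc i , fi>0

sumF-𝟙-== : ∀ {k} (a : Fin k) → sumF (λ j → 𝟙 (a == j)) ≡ 1
sumF-𝟙-== a = trans (sumF-single (λ j → 𝟙 (a == j)) a (λ j j≢a → cong 𝟙 (==-≢ (j≢a ∘ sym)))) (cong 𝟙 (==-refl a))

anyF-intro : ∀ {k} (h : Fin k → Bool) (i : Fin k) → h i ≡ true → anyF h ≡ true
anyF-intro h zero    hi rewrite hi = refl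
anyF-intro h (suc i) hi with h zero
... | true  = refl
... | false = anyF-intro (h ∘ suc) i hi

anyF-elim : ∀ {k} (h : Fin k → Bool) → anyF h ≡ true → ∃ λ i → h i ≡ true
anyF-elim {suc k} h any-h with h zero in h0
... | true  = zero , h0
... | false with anyF-elim (h ∘ suc) any-h
...   | i , hi = suc i , hi

anyF-elim-∧ : ∀ {k} (h h′ : Fin k → Bool) → anyF (λ i → h i ∧ h′ i) ≡ true →
              ∃ λ i → (h i ≡ true) × (h′ i ≡ true)
anyF-elim-∧ h h′ any-hh′ with anyF-elim (λ i → h i ∧ h′ i) any-hh′
... | i , hh′i = i , ∧-true hh′i

anyF-cong : ∀ {k} {h h′ : Fin k → Bool} → (∀ i → h i ≡ h′ i) → anyF h ≡ anyF h′
anyF-cong {zero}  eq = refl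
anyF-cong {suc k} eq = cong₂ _∨_ (eq zero) (anyF-cong (eq ∘ suc))

anyF-∧ˡ : ∀ {k} (b : Bool) (h : Fin k → Bool) → anyF (λ i → b ∧ h i) ≡ b ∧ anyF h
anyF-∧ˡ {zero}  b h = sym (Bool.∧-zeroʳ b)
anyF-∧ˡ {suc k} b h rewrite anyF-∧ˡ b (h ∘ suc) = sym (Bool.∧-distribˡ-∨ b (h zero) _)

anyF-false : ∀ {k} (h : Fin k → Bool) → anyF h ≡ false → ∀ i → h i ≡ false
anyF-false h none i = Bool.¬-not (λ hi → true≢false (trans (sym (anyF-intro h i hi)) none))

anyF-single : ∀ {k} (h h′ : Fin k → Bool) (i₀ : Fin k) → h′ i₀ ≡ true → (∀ i → h′ i ≡ true → i ≡ i₀) →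
              anyF (λ i → h i ∧ h′ i) ≡ h i₀
anyF-single h h′ i₀ h′i₀ only-i₀ with h i₀ in hi₀
... | true  = anyF-intro (λ i → h i ∧ h′ i) i₀ (cong₂ _∧_ hi₀ h′i₀)
... | false = Bool.¬-not λ any → let i , hi , h′i = anyF-elim-∧ h h′ any
                                 in true≢false (trans (sym hi) (trans (cong h (only-i₀ i h′i)) hi₀))

𝟙-anyF : ∀ {k} (R : Fin k → Bool) → (∀ i j → R i ≡ true → R j ≡ true → i ≡ j) →
         𝟙 (anyF R) ≡ sumF (𝟙 ∘ R)
𝟙-anyF R unique with anyF R in any-R
... | false = sym (sumF-zero (λ i → cong 𝟙 (anyF-false R any-R i)))
... | true with anyF-elim R any-R
...   | i₀ , Ri₀ = sym (trans (sumF-single (𝟙 ∘ R) i₀ others) (cong 𝟙 Ri₀))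
  where
  others : ∀ i → i ≢ i₀ → 𝟙 (R i) ≡ 0
  others i i≢i₀ with R i in Ri
  ... | true  = ⊥-elim (i≢i₀ (unique i i₀ Ri Ri₀))
  ... | false = refl

findF : ∀ {k} → (Fin k → Bool) → Maybe (Fin k)
findF h with Fin.any? (λ i → h i Bool.≟ true)
... | yes (i , _) = just i
... | no  _       = nothing

findF-just : ∀ {k} (h : Fin k → Bool) {i} → findF h ≡ just i → h i ≡ true
findF-just h found with Fin.any? (λ i → h i Bool.≟ true)
findF-just h refl | yes (_ , hi) = hi

findF-nothing : ∀ {k} (h : Fin k → Bool) → findF h ≡ nothing → anyF h ≡ false
findF-nothing h none with Fin.any? (λ i → h i Bool.≟ true)
... | no ∄i = Bool.¬-not (∄i ∘ anyF-elim h)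

∑∑ : ∀ {a b} → (Fin a → Fin b → ℕ) → ℕ
∑∑ F = sumF (λ x → sumF (F x))

∑∑-cong : ∀ {a b} {F G : Fin a → Fin b → ℕ} → (∀ x y → F x y ≡ G x y) → ∑∑ F ≡ ∑∑ G
∑∑-cong eq = sumF-cong (λ x → sumF-cong (eq x))

count2-cong : ∀ {n} {R R′ : Fin n → Fin n → Bool} → (∀ x y → R x y ≡ R′ x y) → count2 R ≡ count2 R′
count2-cong eq = ∑∑-cong (λ x y → cong 𝟙 (eq x y))

∑∑-mono : ∀ {a b} {F G : Fin a → Fin b → ℕ} → (∀ x y → F x y ℕ.≤ G x y) → ∑∑ F ℕ.≤ ∑∑ G
∑∑-mono le = sumF-mono (λ x → sumF-mono (le x))

∑∑-distrib-+ : ∀ {a b} (F G : Fin a → Fin b → ℕ) → ∑∑ (λ x y → F x y ℕ.+ G x y) ≡ ∑∑ F ℕ.+ ∑∑ G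
∑∑-distrib-+ F G = trans (sumF-cong (λ x → sumF-distrib-+ (F x) (G x)))
                         (sumF-distrib-+ (λ x → sumF (F x)) (λ x → sumF (G x)))

sumF-∑∑ : ∀ {k a b} (F : Fin k → Fin a → Fin b → ℕ) →
          sumF (λ i → ∑∑ (F i)) ≡ ∑∑ (λ x y → sumF (λ i → F i x y))
sumF-∑∑ F = trans (sumF-comm (λ i x → sumF (F i x))) (sumF-cong (λ x → sumF-comm (λ i → F i x)))

sumF-count2 : ∀ {k n} (R : Fin k → Fin n → Fin n → Bool) →
              (∀ x y i j → R i x y ≡ true → R j x y ≡ true → i ≡ j) →
              sumF (λ i → count2 (R i)) ≡ count2 (λ x y → anyF (λ i → R i x y))
sumF-count2 R unique = trans (sumF-∑∑ (λ i x y → 𝟙 (R i x y)))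
  (∑∑-cong (λ x y → sym (𝟙-anyF (λ i → R i x y) (unique x y))))

sumF-count2-partition : ∀ {k n} (R : Fin n → Fin n → Bool) (F : Fin k → Fin n → Fin n → Bool) →
                        (∀ x y i j → F i x y ≡ true → F j x y ≡ true → i ≡ j) →
                        (∀ x y → R x y ≡ true → anyF (λ i → F i x y) ≡ true) →
                        sumF (λ i → count2 (λ x y → R x y ∧ F i x y)) ≡ count2 R
sumF-count2-partition R F disjoint covered =
  trans (sumF-count2 (λ i x y → R x y ∧ F i x y)
          (λ x y i j RFi RFj → disjoint x y i j (proj₂ (∧-true {R x y} RFi)) (proj₂ (∧-true {R x y} RFj))))
        (∑∑-cong (λ x y → cong 𝟙 (trans (anyF-∧ˡ (R x y) (λ i → F i x y)) (R∧covered x y))))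
  where
  R∧covered : ∀ x y → R x y ∧ anyF (λ i → F i x y) ≡ R x y
  R∧covered x y with R x y in Rxy
  ... | true  = covered x y Rxy
  ... | false = refl

count2-pos-elim : ∀ {n} (R : Fin n → Fin n → Bool) → 0 ℕ.< count2 R → ∃ λ x → ∃ λ y → R x y ≡ true
count2-pos-elim R pos with sumF-pos⇒term-pos (λ x → count (R x)) pos
... | x , pos-x with sumF-pos⇒term-pos (λ y → 𝟙 (R x y)) pos-x
...   | y , pos-xy with R x y in Rxy
...     | true = x , y , Rxy

count2-pos-intro : ∀ {n} (R : Fin n → Fin n → Bool) {x y} → R x y ≡ true → 1 ℕ.≤ count2 R
count2-pos-intro R {x} {y} Rxy = ℕ.≤-trans (ℕ.≤-reflexive (cong 𝟙 (sym Rxy)))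
  (ℕ.≤-trans (term≤sumF (λ y → 𝟙 (R x y)) y) (term≤sumF (λ x → count (R x)) x))

count2-pos-elim-∧ : ∀ {n} (R S : Fin n → Fin n → Bool) → 0 ℕ.< count2 (λ x y → R x y ∧ S x y) →
               ∃ λ x → ∃ λ y → (R x y ≡ true) × (S x y ≡ true)
count2-pos-elim-∧ R S pos with count2-pos-elim (λ x y → R x y ∧ S x y) pos
... | x , y , RSxy = x , y , ∧-true RSxy

selects : ∀ {k} → Maybe (Fin k) → Fin k → Bool
selects nothing  j = false
selects (just i) j = i == j

selects-just : ∀ {k} (r : Maybe (Fin k)) {j} → selects r j ≡ true → r ≡ just j
selects-just (just i) i==j = cong just (==-sound i==j)

mismatch : ∀ {k} → Maybe (Fin k) → Fin k → ℕ
mismatch r a = sumF (λ j → 𝟙 ((a == j) xor selects r j))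

mismatch-nothing : ∀ {k} (a : Fin k) → mismatch nothing a ≡ 1
mismatch-nothing a = trans (sumF-cong (λ j → cong 𝟙 (Bool.xor-identityʳ (a == j)))) (sumF-𝟙-== a)

mismatch-just : ∀ {k} (i a : Fin k) → mismatch (just i) a ℕ.≤ 𝟙 (not (a == i)) ℕ.+ 𝟙 (not (a == i))
mismatch-just i a with a Fin.≟ i
... | yes refl = ℕ.≤-reflexive (sumF-zero (λ j → cong 𝟙 (Bool.xor-same (a == j))))
... | no  _    = begin
  sumF (λ j → 𝟙 ((a == j) xor (i == j)))                 ≤⟨ sumF-mono (λ j → 𝟙-xor (a == j) (i == j)) ⟩
  sumF (λ j → 𝟙 (a == j) ℕ.+ 𝟙 (i == j))                 ≡⟨ sumF-distrib-+ (λ j → 𝟙 (a == j)) (λ j → 𝟙 (i == j)) ⟩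
  sumF (λ j → 𝟙 (a == j)) ℕ.+ sumF (λ j → 𝟙 (i == j))    ≡⟨ cong₂ ℕ._+_ (sumF-𝟙-== a) (sumF-𝟙-== i) ⟩
  2                                                       ∎
  where
  open ℕ.≤-Reasoning
  𝟙-xor : ∀ b b′ → 𝟙 (b xor b′) ℕ.≤ 𝟙 b ℕ.+ 𝟙 b′
  𝟙-xor true  true  = z≤n
  𝟙-xor true  false = ℕ.≤-refl
  𝟙-xor false _     = ℕ.≤-refl

𝟙-*-mismatch-bound : ∀ {m} Q V a → (Q ≡ true → V ≡ true) → m ℕ.≤ 𝟙 (not a) ℕ.+ 𝟙 (not a) →
                     𝟙 Q ℕ.* m ℕ.≤ 𝟙 (Q ∧ not (V ∧ a)) ℕ.+ 𝟙 (Q ∧ not (V ∧ a))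
𝟙-*-mismatch-bound false V a _   _     = z≤n
𝟙-*-mismatch-bound {m} true  V a Q⇒V m≤ rewrite Q⇒V refl = ℕ.≤-trans (ℕ.≤-reflexive (ℕ.+-identityʳ m)) m≤

⟦⟧≡mkℚ : ∀ a → ⟦ a ⟧ ≡ mkℚ (ℤ.+ a) 0 (Coprime.sym (Coprime.1-coprimeTo a))
⟦⟧≡mkℚ a = ℚ.normalize-coprime (Coprime.sym (Coprime.1-coprimeTo a))

⟦⟧-+ : ∀ a b → ⟦ a ℕ.+ b ⟧ ≡ ⟦ a ⟧ + ⟦ b ⟧
⟦⟧-+ a b = ℚ.toℚᵘ-injective (ℚᵘ.≃-trans lhs (ℚᵘ.≃-sym (ℚ.toℚᵘ-homo-+ ⟦ a ⟧ ⟦ b ⟧)))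
  where
  lhs : ℚ.toℚᵘ ⟦ a ℕ.+ b ⟧ ℚᵘ.≃ ℚ.toℚᵘ ⟦ a ⟧ ℚᵘ.+ ℚ.toℚᵘ ⟦ b ⟧
  lhs rewrite ⟦⟧≡mkℚ (a ℕ.+ b) | ⟦⟧≡mkℚ a | ⟦⟧≡mkℚ b = ℚᵘ.*≡* (trans (ℤ.*-identityʳ _)
    (sym (trans (ℤ.*-identityʳ _) (cong₂ ℤ._+_ (ℤ.*-identityʳ (ℤ.+ a)) (ℤ.*-identityʳ (ℤ.+ b))))))

⟦⟧-mono-≤ : ∀ {a b} → a ℕ.≤ b → ⟦ a ⟧ ≤ ⟦ b ⟧
⟦⟧-mono-≤ {a} {b} a≤b rewrite ⟦⟧≡mkℚ a | ⟦⟧≡mkℚ b =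
  ℚ.*≤* (subst₂ ℤ._≤_ (sym (ℤ.*-identityʳ _)) (sym (ℤ.*-identityʳ _)) (ℤ.+≤+ a≤b))

⟦⟧-nonNeg : ∀ a → 0ℚ ≤ ⟦ a ⟧
⟦⟧-nonNeg a = ⟦⟧-mono-≤ {0} {a} z≤n

⟦⟧-pos : ∀ {a} → 1 ℕ.≤ a → 0ℚ < ⟦ a ⟧
⟦⟧-pos 1≤a = ℚ.<-≤-trans (ℚ.positive⁻¹ ℚ.1ℚ) (⟦⟧-mono-≤ 1≤a)

⟦sumF⟧ : ∀ {k} (f : Fin k → ℕ) → ⟦ sumF f ⟧ ≡ ℚΣ.sum (⟦_⟧ ∘ f)
⟦sumF⟧ {zero}  f = refl
⟦sumF⟧ {suc k} f = trans (⟦⟧-+ (f zero) _) (cong (⟦ f zero ⟧ +_) (⟦sumF⟧ (f ∘ suc)))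

sum-mono-≤ : ∀ {k} {f g : Fin k → ℚ} → (∀ i → f i ≤ g i) → ℚΣ.sum f ≤ ℚΣ.sum g
sum-mono-≤ {zero}  le = ℚ.≤-refl
sum-mono-≤ {suc k} le = ℚ.+-mono-≤ (le zero) (sum-mono-≤ (le ∘ suc))

sum-mono-< : ∀ {k} {f g : Fin (suc k) → ℚ} → (∀ i → f i < g i) → ℚΣ.sum f < ℚΣ.sum g
sum-mono-< {zero}  lt = ℚ.+-mono-<-≤ (lt zero) ℚ.≤-refl
sum-mono-< {suc k} lt = ℚ.+-mono-< (lt zero) (sum-mono-< (lt ∘ suc))

sum-≤⇒∃-≤ : ∀ {k} (f g : Fin k → ℚ) → Fin k → ℚΣ.sum f ≤ ℚΣ.sum g → ∃ λ j → f j ≤ g j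
sum-≤⇒∃-≤ {suc k} f g _ ∑f≤∑g with Fin.any? (λ j → f j ℚ.≤? g j)
... | yes found = found
... | no none = ⊥-elim (ℚ.<-irrefl refl (ℚ.<-≤-trans (sum-mono-< (λ j → ℚ.≰⇒> (λ fj≤gj → none (j , fj≤gj)))) ∑f≤∑g))

≤-+-nonNeg : ∀ {a b c} → a ≤ b → 0ℚ ≤ c → a ≤ b + c
≤-+-nonNeg {a} {b} {c} a≤b 0≤c = ℚ.≤-trans a≤b (subst (_≤ b + c) (ℚ.+-identityʳ b) (ℚ.+-monoʳ-≤ b 0≤c))

*-nonNeg : ∀ {δ X} → 0ℚ ≤ δ → 0ℚ ≤ X → 0ℚ ≤ δ * X
*-nonNeg {δ} {X} 0≤δ 0≤X = ℚ.nonNegative⁻¹ (δ * X)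
  {{ℚ.nonNeg*nonNeg⇒nonNeg δ {{ℚ.nonNegative 0≤δ}} X {{ℚ.nonNegative 0≤X}}}}

1≤⟦3⟧ : ℚ.1ℚ ≤ ⟦ 3 ⟧
1≤⟦3⟧ = ⟦⟧-mono-≤ {1} {3} (s≤s z≤n)

nonNeg-of-≤-*-pos : ∀ {δ X b} → 0ℚ < X → 0ℚ ≤ b → b ≤ δ * X → 0ℚ ≤ δ
nonNeg-of-≤-*-pos {δ} {X} 0<X 0≤b b≤δX with 0ℚ ℚ.≤? δ
... | yes 0≤δ = 0≤δ
... | no  0≰δ = ⊥-elim (ℚ.<-irrefl refl (ℚ.≤-<-trans (ℚ.≤-trans 0≤b b≤δX) δX<0))
  where
  δX<0 : δ * X < 0ℚ
  δX<0 = subst (δ * X <_) (ℚ.*-zeroˡ X) (ℚ.*-monoˡ-<-pos X {{ℚ.positive 0<X}} (ℚ.≰⇒> 0≰δ))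

⟦3⟧*-expand : ∀ δ X → ⟦ 3 ⟧ * δ * X ≡ δ * X + (δ * X + δ * X)
⟦3⟧*-expand δ X = begin
  ⟦ 3 ⟧ * δ * X                                ≡⟨ ℚ.*-assoc ⟦ 3 ⟧ δ X ⟩
  (ℚ.1ℚ + (ℚ.1ℚ + ℚ.1ℚ)) * (δ * X)             ≡⟨ ℚ.*-distribʳ-+ (δ * X) ℚ.1ℚ (ℚ.1ℚ + ℚ.1ℚ) ⟩
  ℚ.1ℚ * (δ * X) + (ℚ.1ℚ + ℚ.1ℚ) * (δ * X)     ≡⟨ cong (ℚ.1ℚ * (δ * X) +_) (ℚ.*-distribʳ-+ (δ * X) ℚ.1ℚ ℚ.1ℚ) ⟩
  ℚ.1ℚ * (δ * X) + (ℚ.1ℚ * (δ * X) + ℚ.1ℚ * (δ * X))  ≡⟨ cong₂ (λ u v → u + (v + v)) (ℚ.*-identityˡ (δ * X)) (ℚ.*-identityˡ (δ * X)) ⟩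
  δ * X + (δ * X + δ * X)                      ∎
  where open ≡-Reasoning

module _ {n : ℕ} where

  AgreeOn : (A B : Subset n) → (E E′ : Fin n → Fin n → Bool) → Set
  AgreeOn A B E E′ = ∀ x y → A x ≡ true → B y ≡ true → E x y ≡ E′ x y

  eG-cong : ∀ {A B E E′} → AgreeOn A B E E′ → eG E A B ≡ eG E′ A B
  eG-cong {A} {B} {E} {E′} agree = ∑∑-cong pointwise
    where
    pointwise : ∀ x y → 𝟙 (A x ∧ B y ∧ E x y) ≡ 𝟙 (A x ∧ B y ∧ E′ x y)
    pointwise x y with A x in Ax | B y in By
    ... | true  | true  = cong 𝟙 (agree x y Ax By)
    ... | true  | false = refl
    ... | false | _     = refl

  AgreeOn-⊆ : ∀ {A B A′ B′ E E′} → A′ ⊆ A → B′ ⊆ B → AgreeOn A B E E′ → AgreeOn A′ B′ E E′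
  AgreeOn-⊆ A′⊆A B′⊆B agree x y A′x B′y = agree x y (A′⊆A x A′x) (B′⊆B y B′y)

  eG-empty : ∀ {A B E} → AgreeOn A B E (λ _ _ → false) → eG E A B ≡ 0
  eG-empty {A} {B} agree = trans (eG-cong agree)
    (sumF-zero (λ x → sumF-zero (λ y → cong 𝟙 (trans (cong (A x ∧_) (Bool.∧-zeroʳ (B y))) (Bool.∧-zeroʳ (A x))))))

  eG-flip : ∀ (E : Fin n → Fin n → Bool) (A B : Subset n) → eG (flip E) B A ≡ eG E A B
  eG-flip E A B = trans (sumF-comm (λ y x → 𝟙 (B y ∧ A x ∧ E x y)))
    (∑∑-cong (λ x y → cong 𝟙 (∧-swapˡ (B y) (A x) (E x y))))
    where
    ∧-swapˡ : ∀ a b c → a ∧ b ∧ c ≡ b ∧ a ∧ c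
    ∧-swapˡ a b c = trans (sym (Bool.∧-assoc a b c)) (trans (cong (_∧ c) (Bool.∧-comm a b)) (Bool.∧-assoc b a c))

  eG-⋃ : ∀ {k} (F : Fin k → Fin n → Fin n → Bool) → (∀ x y i j → F i x y ≡ true → F j x y ≡ true → i ≡ j) →
         ∀ A B → eG (λ x y → anyF (λ i → F i x y)) A B ≡ sumF (λ i → eG (F i) A B)
  eG-⋃ F disjoint A B = sym (trans
    (sumF-count2 (λ i x y → A x ∧ B y ∧ F i x y)
      (λ x y i j Ri Rj → disjoint x y i j (proj₂ (∧-true (proj₂ (∧-true {A x} Ri)))) (proj₂ (∧-true (proj₂ (∧-true {A x} Rj))))))
    (∑∑-cong (λ x y → cong 𝟙 (trans (anyF-∧ˡ (A x) (λ i → B y ∧ F i x y))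
                                     (cong (A x ∧_) (anyF-∧ˡ (B y) (λ i → F i x y)))))))

module _ {n : ℕ} {δ : ℚ} where

  Regular-cong : ∀ {A B : Subset n} {E E′ : Fin n → Fin n → Bool} → AgreeOn A B E E′ → Regular δ E A B → Regular δ E′ A B
  Regular-cong {A} {B} {E} {E′} agree regular A′ B′ A′⊆A B′⊆B |A′|≥ |B′|≥ =
    subst₂ (λ u v → u ℕ.* count A′ ℕ.* count B′ ℕ.≤ 2 ℕ.* v ℕ.* count A ℕ.* count B)
      (eG-cong agree) (eG-cong (AgreeOn-⊆ A′⊆A B′⊆B agree))
      (regular A′ B′ A′⊆A B′⊆B |A′|≥ |B′|≥)

  Regular-empty : ∀ {A B : Subset n} {E : Fin n → Fin n → Bool} → AgreeOn A B E (λ _ _ → false) → Regular δ E A B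
  Regular-empty {A} {B} {E} agree A′ B′ _ _ _ _ rewrite eG-empty {A = A} {B} {E} agree = z≤n

  Regular-flip : ∀ {A B : Subset n} {E : Fin n → Fin n → Bool} → Regular δ E A B → Regular δ (flip E) B A
  Regular-flip {A} {B} {E} regular B′ A′ B′⊆B A′⊆A |B′|≥ |A′|≥ =
    subst₂ ℕ._≤_
      (trans (swap (eG E A B) (count A′) (count B′)) (cong (λ e → e ℕ.* count B′ ℕ.* count A′) (sym (eG-flip E A B))))
      (trans (swap (2 ℕ.* eG E A′ B′) (count A) (count B))
             (cong (λ e → 2 ℕ.* e ℕ.* count B ℕ.* count A) (sym (eG-flip E A′ B′))))
      (regular A′ B′ A′⊆A B′⊆B |A′|≥ |B′|≥)
    where
    swap : ∀ e a b → e ℕ.* a ℕ.* b ≡ e ℕ.* b ℕ.* a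
    swap = solve-∀

  Regular-⋃ : ∀ {k} {A B : Subset n} (F : Fin k → Fin n → Fin n → Bool) →
              (∀ x y i j → F i x y ≡ true → F j x y ≡ true → i ≡ j) →
              (∀ i → Regular δ (F i) A B) → Regular δ (λ x y → anyF (λ i → F i x y)) A B
  Regular-⋃ {k} {A} {B} F disjoint regular A′ B′ A′⊆A B′⊆B |A′|≥ |B′|≥ =
    subst₂ (λ u v → u ℕ.* count A′ ℕ.* count B′ ℕ.≤ 2 ℕ.* v ℕ.* count A ℕ.* count B)
      (sym (eG-⋃ F disjoint A B)) (sym (eG-⋃ F disjoint A′ B′))
      (sumF-bound (λ i → regular i A′ B′ A′⊆A B′⊆B |A′|≥ |B′|≥))
    where
    sumF-bound : ∀ {f g : Fin k → ℕ} {a b a′ b′} → (∀ i → f i ℕ.* a′ ℕ.* b′ ℕ.≤ 2 ℕ.* g i ℕ.* a ℕ.* b) →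
                 sumF f ℕ.* a′ ℕ.* b′ ℕ.≤ 2 ℕ.* sumF g ℕ.* a ℕ.* b
    sumF-bound {f} {g} {a} {b} {a′} {b′} bound = begin
      sumF f ℕ.* a′ ℕ.* b′                  ≡⟨ shuffle₁ (sumF f) a′ b′ ⟩
      a′ ℕ.* b′ ℕ.* sumF f                  ≡⟨ sumF-distribˡ-* (a′ ℕ.* b′) f ⟨
      sumF (λ i → a′ ℕ.* b′ ℕ.* f i)        ≤⟨ sumF-mono (λ i → ℕ.≤-trans (ℕ.≤-reflexive (sym (shuffle₁ (f i) a′ b′)))
                                                  (ℕ.≤-trans (bound i) (ℕ.≤-reflexive (shuffle₂ (g i) a b)))) ⟩
      sumF (λ i → 2 ℕ.* a ℕ.* b ℕ.* g i)    ≡⟨ sumF-distribˡ-* (2 ℕ.* a ℕ.* b) g ⟩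
      2 ℕ.* a ℕ.* b ℕ.* sumF g              ≡⟨ shuffle₂ (sumF g) a b ⟨
      2 ℕ.* sumF g ℕ.* a ℕ.* b              ∎
      where
      open ℕ.≤-Reasoning
      shuffle₁ : ∀ s a′ b′ → s ℕ.* a′ ℕ.* b′ ≡ a′ ℕ.* b′ ℕ.* s
      shuffle₁ = solve-∀
      shuffle₂ : ∀ s a b → 2 ℕ.* s ℕ.* a ℕ.* b ≡ 2 ℕ.* a ℕ.* b ℕ.* s
      shuffle₂ = solve-∀

  Regular-∧ : ∀ {A B : Subset n} {E : Fin n → Fin n → Bool} b → Regular δ E A B →
              Regular δ (λ x y → b ∧ E x y) A B
  Regular-∧ true  regular = regular
  Regular-∧ false _       = Regular-empty (λ _ _ _ _ → refl)

Regular-mono : ∀ {n δ δ′} {E : Fin n → Fin n → Bool} {A B : Subset n} →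
               δ ≤ δ′ → Regular δ E A B → Regular δ′ E A B
Regular-mono {δ = δ} {δ′} {A = A} {B} δ≤δ′ regular A′ B′ A′⊆A B′⊆B |A′|≥ |B′|≥ =
  regular A′ B′ A′⊆A B′⊆B (ℚ.≤-trans (scale (count A)) |A′|≥) (ℚ.≤-trans (scale (count B)) |B′|≥)
  where
  scale : ∀ c → δ * ⟦ c ⟧ ≤ δ′ * ⟦ c ⟧
  scale c = ℚ.*-monoʳ-≤-nonNeg ⟦ c ⟧ {{ℚ.nonNegative (⟦⟧-nonNeg c)}} δ≤δ′

module _ {n : ℕ} where

  Asymmetric : (Fin n → Fin n → Bool) → Set
  Asymmetric V = ∀ x y → V x y ≡ true → V y x ≡ false

  Symmetric : (Fin n → Fin n → Bool) → Set
  Symmetric H = ∀ x y → H x y ≡ H y x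

  SupportedOn : (V H : Fin n → Fin n → Bool) → Set
  SupportedOn V H = ∀ x y → H x y ≡ true → (V x y ∨ V y x) ≡ true

  count2-double : ∀ {V H} → Asymmetric V → Symmetric H → SupportedOn V H →
                  count2 (λ x y → V x y ∧ H x y) ℕ.+ count2 (λ x y → V x y ∧ H x y) ≡ count2 H
  count2-double {V} {H} asym sym-H supp = begin
    count2 (λ x y → V x y ∧ H x y) ℕ.+ count2 (λ x y → V x y ∧ H x y)
      ≡⟨ cong (count2 (λ x y → V x y ∧ H x y) ℕ.+_) reversed ⟩
    count2 (λ x y → V x y ∧ H x y) ℕ.+ ∑∑ (λ x y → 𝟙 (V y x ∧ H x y))
      ≡⟨ ∑∑-distrib-+ (λ x y → 𝟙 (V x y ∧ H x y)) (λ x y → 𝟙 (V y x ∧ H x y)) ⟨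
    ∑∑ (λ x y → 𝟙 (V x y ∧ H x y) ℕ.+ 𝟙 (V y x ∧ H x y))
      ≡⟨ ∑∑-cong split ⟨
    count2 H ∎
    where
    open ≡-Reasoning
    reversed : count2 (λ x y → V x y ∧ H x y) ≡ ∑∑ (λ x y → 𝟙 (V y x ∧ H x y))
    reversed = trans (sumF-comm (λ y x → 𝟙 (V y x ∧ H y x)))
                     (∑∑-cong (λ x y → cong (λ h → 𝟙 (V y x ∧ h)) (sym-H y x)))
    split : ∀ x y → 𝟙 (H x y) ≡ 𝟙 (V x y ∧ H x y) ℕ.+ 𝟙 (V y x ∧ H x y)
    split x y with H x y in Hxy
    ... | false rewrite Bool.∧-zeroʳ (V x y) | Bool.∧-zeroʳ (V y x) = refl
    ... | true with V x y in Vxy | supp x y Hxy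
    ...   | true  | _   rewrite asym x y Vxy = refl
    ...   | false | Vyx rewrite Vyx = refl

  SupportedOn-either : ∀ {V} (h : Fin n → Fin n → Bool) → SupportedOn V (λ x y → (V x y ∧ h x y) ∨ (V y x ∧ h y x))
  SupportedOn-either {V} h x y either with V x y
  ... | true  = refl
  ... | false = proj₁ (∧-true either)

  SupportedOn-xor : ∀ {V H H′} → SupportedOn V H → SupportedOn V H′ → SupportedOn V (λ x y → H x y xor H′ x y)
  SupportedOn-xor {H = H} {H′} supp supp′ x y differ with H x y in Hxy | H′ x y in H′xy
  ... | true  | _    = supp x y Hxy
  ... | false | true = supp′ x y H′xy

  <ᵇ : Fin n → Fin n → Bool
  <ᵇ x y = does (x Fin.<? y)

  <ᵇ-asym : Asymmetric <ᵇ
  <ᵇ-asym x y x<ᵇy with Fin.<-cmp x y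
  ... | tri< x<y _ _ = dec-false (y Fin.<? x) (Fin.<-asym x<y)
  ... | tri≈ x≮y _ _ with () ← trans (sym x<ᵇy) (dec-false (x Fin.<? y) x≮y)
  ... | tri> x≮y _ _ with () ← trans (sym x<ᵇy) (dec-false (x Fin.<? y) x≮y)

  SupportedOn-<ᵇ : ∀ {V H} → Asymmetric V → SupportedOn V H → SupportedOn <ᵇ H
  SupportedOn-<ᵇ {V} asym supp x y Hxy with Fin.<-cmp x y
  ... | tri< x<y _ _ rewrite dec-true (x Fin.<? y) x<y = refl
  ... | tri> _ _ y<x rewrite dec-true (y Fin.<? x) y<x = Bool.∨-zeroʳ (<ᵇ x y)
  ... | tri≈ _ refl _ with V x x in Vxx | supp x x Hxy
  ...   | true  | _ with () ← trans (sym Vxx) (asym x x Vxx)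

  edgesOf≡count2 : ∀ {V H} → Asymmetric V → Symmetric H → SupportedOn V H →
                   edgesOf H ≡ count2 (λ x y → V x y ∧ H x y)
  edgesOf≡count2 asym sym-H supp = double-injective (trans
    (count2-double <ᵇ-asym sym-H (SupportedOn-<ᵇ asym supp)) (sym (count2-double asym sym-H supp)))
    where
    double-injective : ∀ {a b} → a ℕ.+ a ≡ b ℕ.+ b → a ≡ b
    double-injective {a} {b} eq = ℕ.*-cancelˡ-≡ a b 2 (subst₂ _≡_ (double a) (double b) eq)
      where double : ∀ m → m ℕ.+ m ≡ 2 ℕ.* m
            double m = cong (m ℕ.+_) (sym (ℕ.+-identityʳ m))

module Construction {n : ℕ} (vp : Fin n → Fin 3) (P : TwoPartition n) (refines : Refines vp P) where
  open TwoPartition P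

  Ê : Fin m → Fin n → Fin n → Bool
  Ê e x y = edge e x y ∨ edge e y x

  V₁₂ : Fin n → Fin n → Bool
  V₁₂ = V₁×V₂ vp P

  V₁₂-sound : ∀ {x y} → V₁₂ x y ≡ true → (vp x ≡ v₁) × (vp y ≡ v₂)
  V₁₂-sound {x} V₁₂xy with ∧-true {vp x == v₁} V₁₂xy
  ... | x∈V₁ , y∈V₂ = ==-sound x∈V₁ , ==-sound y∈V₂

  V₁₂-complete : ∀ {x y} → vp x ≡ v₁ → vp y ≡ v₂ → V₁₂ x y ≡ true
  V₁₂-complete x∈V₁ y∈V₂ rewrite x∈V₁ | y∈V₂ = refl

  V₁₂-asym : Asymmetric V₁₂
  V₁₂-asym x y V₁₂xy with V₁₂ y x in V₁₂yx
  ... | false = refl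
  ... | true with () ← trans (sym (proj₁ (V₁₂-sound V₁₂xy))) (proj₂ (V₁₂-sound V₁₂yx))

  V₁₂-covered : ∀ {x y} → V₁₂ x y ≡ true → ∃ λ e → Ê e x y ≡ true
  V₁₂-covered {x} {y} V₁₂xy = cover x y λ Zx≡Zy →
    let x∈V₁ , y∈V₂ = V₁₂-sound V₁₂xy in v₁≢v₂ (trans (sym x∈V₁) (trans (refines x y Zx≡Zy) y∈V₂))
    where v₁≢v₂ : v₁ ≢ v₂
          v₁≢v₂ ()

  ∉V₃ : ∀ {u i} → vp u ≡ i → i ≢ v₃ → not (vp u == v₃) ≡ true
  ∉V₃ vpu≡i i≢v₃ = cong not (==-≢ (λ vpu≡v₃ → i≢v₃ (trans (sym vpu≡i) vpu≡v₃)))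

  V₁₂-outside-V₃ : ∀ {x y} → (V₁₂ x y ∨ V₁₂ y x) ≡ true → (not (vp x == v₃) ≡ true) × (not (vp y == v₃) ≡ true)
  V₁₂-outside-V₃ {x} {y} V₁₂xy∨V₁₂yx with V₁₂ x y in V₁₂xy
  ... | true  = let x∈V₁ , y∈V₂ = V₁₂-sound V₁₂xy in ∉V₃ x∈V₁ (λ ()) , ∉V₃ y∈V₂ (λ ())
  ... | false = let y∈V₁ , x∈V₂ = V₁₂-sound V₁₂xy∨V₁₂yx in ∉V₃ x∈V₂ (λ ()) , ∉V₃ y∈V₁ (λ ())

  part : Fin k → Subset n
  part c x = Z x == c


  edge-classes : ∀ {e x y c c′} → part c x ≡ true → part c′ y ≡ true → edge e x y ≡ true →
                 (cA e ≡ c) × (cB e ≡ c′)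
  edge-classes {e} {x} {y} x∈c y∈c′ exy with edge-in e x y exy
  ... | Zx≡cA , Zy≡cB = trans (sym Zx≡cA) (==-sound x∈c) , trans (sym Zy≡cB) (==-sound y∈c′)

  Regular-Ê : ∀ {δ} → Good δ → ∀ e c c′ → Regular δ (Ê e) (part c) (part c′)
  Regular-Ê {δ} good e c c′ = by-cases e c c′ ((cA e Fin.≟ c) ×-dec (cB e Fin.≟ c′)) ((cA e Fin.≟ c′) ×-dec (cB e Fin.≟ c))
    where
    by-cases : ∀ e c c′ → Dec ((cA e ≡ c) × (cB e ≡ c′)) → Dec ((cA e ≡ c′) × (cB e ≡ c)) →
               Regular δ (Ê e) (part c) (part c′)
    by-cases e _ _ (yes (refl , refl)) _ =
      Regular-cong {δ = δ} {A = classA e} {classB e} {edge e} {Ê e} forward (good e)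
      where
      forward : AgreeOn (classA e) (classB e) (edge e) (Ê e)
      forward x y x∈c y∈c′ = sym (trans (cong (edge e x y ∨_) (Bool.¬-not (λ eyx →
        cA≢cB e (proj₁ (edge-classes y∈c′ x∈c eyx))))) (Bool.∨-identityʳ (edge e x y)))
    by-cases e _ _ (no _) (yes (refl , refl)) =
      Regular-cong {δ = δ} {A = classB e} {classA e} {flip (edge e)} {Ê e} backward
        (Regular-flip {δ = δ} {A = classA e} {classB e} {edge e} (good e))
      where
      backward : AgreeOn (classB e) (classA e) (flip (edge e)) (Ê e)
      backward x y x∈c y∈c′ = sym (cong (_∨ edge e y x) (Bool.¬-not (λ exy →
        cA≢cB e (proj₁ (edge-classes x∈c y∈c′ exy)))))
    by-cases e c c′ (no ¬forward) (no ¬backward) =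
      Regular-empty {δ = δ} {A = part c} {part c′} {Ê e} none
      where
      none : AgreeOn (part c) (part c′) (Ê e) (λ _ _ → false)
      none x y x∈c y∈c′ = cong₂ _∨_ (Bool.¬-not (¬forward ∘ edge-classes x∈c y∈c′))
                                    (Bool.¬-not (¬backward ∘ edge-classes y∈c′ x∈c))

  Ê-classes : ∀ e x y → Ê e x y ≡ true → (Z x ≡ cA e × Z y ≡ cB e) ⊎ (Z x ≡ cB e × Z y ≡ cA e)
  Ê-classes e x y Êxy with edge e x y in exy
  ... | true  = inj₁ (edge-in e x y exy)
  ... | false with edge-in e y x Êxy
  ...   | Zy≡cA , Zx≡cB = inj₂ (Zx≡cB , Zy≡cA)

  inCls-intro : ∀ {x c i} → Z x ≡ c → vp x ≡ i → inCls vp P c i ≡ true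
  inCls-intro {x} {c} {i} Zx≡c vpx≡i = anyF-intro _ x
    (cong₂ _∧_ (trans (cong (_== c) Zx≡c) (==-refl c)) (trans (cong (_== i) vpx≡i) (==-refl i)))

  Ê-meets-V₁₂⇒∈ℰ₃ : ∀ e {x₀ y₀} → V₁₂ x₀ y₀ ≡ true → Ê e x₀ y₀ ≡ true → isE₃ vp P e ≡ true
  Ê-meets-V₁₂⇒∈ℰ₃ e {x₀} {y₀} V₁₂x₀y₀ Êx₀y₀ with V₁₂-sound V₁₂x₀y₀ | Ê-classes e x₀ y₀ Êx₀y₀
  ... | x₀∈V₁ , y₀∈V₂ | inj₁ (Zx₀≡cA , Zy₀≡cB)
    rewrite inCls-intro Zx₀≡cA x₀∈V₁ | inCls-intro Zy₀≡cB y₀∈V₂ = refl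
  ... | x₀∈V₁ , y₀∈V₂ | inj₂ (Zx₀≡cB , Zy₀≡cA)
    rewrite inCls-intro Zy₀≡cA y₀∈V₂ | inCls-intro Zx₀≡cB x₀∈V₁ = Bool.∨-zeroʳ _

  Ê-same-parts : ∀ e {x₀ y₀ x y} → Ê e x₀ y₀ ≡ true → Ê e x y ≡ true →
                 (Z x ≡ Z x₀ × Z y ≡ Z y₀) ⊎ (Z y ≡ Z x₀ × Z x ≡ Z y₀)
  Ê-same-parts e {x₀} {y₀} {x} {y} Êx₀y₀ Êxy with Ê-classes e x₀ y₀ Êx₀y₀ | Ê-classes e x y Êxy
  ... | inj₁ (x₀A , y₀B) | inj₁ (xA , yB) = inj₁ (trans xA (sym x₀A) , trans yB (sym y₀B))
  ... | inj₁ (x₀A , y₀B) | inj₂ (xB , yA) = inj₂ (trans yA (sym x₀A) , trans xB (sym y₀B))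
  ... | inj₂ (x₀B , y₀A) | inj₁ (xA , yB) = inj₂ (trans yB (sym x₀B) , trans xA (sym y₀A))
  ... | inj₂ (x₀B , y₀A) | inj₂ (xB , yA) = inj₁ (trans xB (sym x₀B) , trans yA (sym y₀A))

  V₁₂-transport : ∀ {x₀ y₀ x y} → Z x ≡ Z x₀ → Z y ≡ Z y₀ → V₁₂ x₀ y₀ ≡ true → V₁₂ x y ≡ true
  V₁₂-transport {x₀} {y₀} {x} {y} Zx≡ Zy≡ V₁₂x₀y₀ with V₁₂-sound V₁₂x₀y₀
  ... | x₀∈V₁ , y₀∈V₂ = V₁₂-complete (trans (refines x x₀ Zx≡) x₀∈V₁) (trans (refines y y₀ Zy≡) y₀∈V₂)

  Ê-meets-V₁₂⇒⊆V₁₂ : ∀ e {x₀ y₀} → V₁₂ x₀ y₀ ≡ true → Ê e x₀ y₀ ≡ true →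
                     ∀ x y → Ê e x y ≡ true → (V₁₂ x y ∨ V₁₂ y x) ≡ true
  Ê-meets-V₁₂⇒⊆V₁₂ e V₁₂x₀y₀ Êx₀y₀ x y Êxy with Ê-same-parts e Êx₀y₀ Êxy
  ... | inj₁ (Zx≡ , Zy≡) rewrite V₁₂-transport Zx≡ Zy≡ V₁₂x₀y₀ = refl
  ... | inj₂ (Zy≡ , Zx≡) rewrite V₁₂-transport Zy≡ Zx≡ V₁₂x₀y₀ = Bool.∨-zeroʳ (V₁₂ x y)

  module _ {p : ℕ} (g : Fin n → Fin n → Fin p) (δ : ℚ) where

    𝒢 : Fin p → Fin n → Fin n → Bool
    𝒢 j x y = V₁₂ x y ∧ (g x y == j)

    q : Fin m → ℕ
    q e = count2 (Qset vp P e)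

    out : Fin m → Fin p → ℕ
    out e j = count2 (λ x y → Qset vp P e x y ∧ not (𝒢 j x y))

    fits : Fin m → Fin p → Bool
    fits = subβ vp P 𝒢 δ

    fits-sound : ∀ e j → fits e j ≡ true → ⟦ out e j ⟧ < δ * ⟦ q e ⟧
    fits-sound e j fits-ej = ℚ.≰⇒> λ δq≤out →
      true≢false (trans (sym fits-ej) (cong not (Equivalence.to Bool.T-≡ (ℚ.≤⇒≤ᵇ δq≤out))))

    fits⇒q>0 : ∀ e j → fits e j ≡ true → 0 ℕ.< q e
    fits⇒q>0 e j fits-ej = ℕ.n≢0⇒n>0 λ q≡0 → ℚ.<-irrefl refl (ℚ.≤-<-trans (⟦⟧-nonNeg (out e j))
      (subst (⟦ out e j ⟧ <_) (trans (cong (λ t → δ * ⟦ t ⟧) q≡0) (ℚ.*-zeroʳ δ)) (fits-sound e j fits-ej)))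

    fits⇒meets-V₁₂ : ∀ e j → fits e j ≡ true → ∃ λ x₀ → ∃ λ y₀ → (V₁₂ x₀ y₀ ≡ true) × (Ê e x₀ y₀ ≡ true)
    fits⇒meets-V₁₂ e j fits-ej = count2-pos-elim-∧ V₁₂ (Ê e) (fits⇒q>0 e j fits-ej)

    assign : Fin m → Maybe (Fin p)
    assign e = findF (fits e)

    G′ : Fin p → Fin n → Fin n → Bool
    G′ j x y = anyF (λ e → selects (assign e) j ∧ Ê e x y)

    G′-sym : ∀ j → Symmetric (G′ j)
    G′-sym j x y = anyF-cong (λ e → cong (selects (assign e) j ∧_) (Bool.∨-comm (edge e x y) (edge e y x)))

    G′-supp : ∀ j → SupportedOn V₁₂ (G′ j)
    G′-supp j x y G′xy =
      let e , sel , Êxy = anyF-elim-∧ (λ e → selects (assign e) j) (λ e → Ê e x y) G′xy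
          x₀ , y₀ , V₁₂x₀y₀ , Êx₀y₀ = fits⇒meets-V₁₂ e j (findF-just (fits e) (selects-just (assign e) sel))
      in Ê-meets-V₁₂⇒⊆V₁₂ e V₁₂x₀y₀ Êx₀y₀ x y Êxy

    Regular-G′ : Good δ → ∀ j c c′ → Regular δ (G′ j) (part c) (part c′)
    Regular-G′ good j c c′ =
      Regular-⋃ {δ = δ} (λ e x y → selects (assign e) j ∧ Ê e x y)
        (λ x y e e′ Fe Fe′ → disjoint e e′ x y (proj₂ (∧-true {selects (assign e) j} Fe))
                                             (proj₂ (∧-true {selects (assign e′) j} Fe′)))
        (λ e → Regular-∧ {δ = δ} (selects (assign e) j) (Regular-Ê {δ} good e c c′))

    -- 𝒢 j is G_j as a set of pairs of V₁ × V₂; Ĝ j is the same graph as a symmetric relation.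
    Ĝ : Fin p → Fin n → Fin n → Bool
    Ĝ j x y = 𝒢 j x y ∨ 𝒢 j y x

    Ĝ-sym : ∀ j → Symmetric (Ĝ j)
    Ĝ-sym j x y = Bool.∨-comm (𝒢 j x y) (𝒢 j y x)

    Ĝ-on-V₁₂ : ∀ j {x y} → V₁₂ x y ≡ true → Ĝ j x y ≡ (g x y == j)
    Ĝ-on-V₁₂ j {x} {y} V₁₂xy rewrite V₁₂xy | V₁₂-asym x y V₁₂xy = Bool.∨-identityʳ (g x y == j)

    G′-on-Ê : ∀ j {e₀ x y} → Ê e₀ x y ≡ true → G′ j x y ≡ selects (assign e₀) j
    G′-on-Ê j {e₀} {x} {y} Êe₀ = anyF-single (λ e → selects (assign e) j) (λ e → Ê e x y) e₀ Êe₀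
                                   (λ e Êe → disjoint e e₀ x y Êe Êe₀)

    edgesOf-Ĝ : ∀ j → edgesOf (Ĝ j) ≡ count2 (𝒢 j)
    edgesOf-Ĝ j = trans (edgesOf≡count2 {V = V₁₂} {Ĝ j} V₁₂-asym (Ĝ-sym j) (SupportedOn-either {V = V₁₂} (λ x y → g x y == j)))
                        (count2-cong (λ x y → ∧-cong-true {V₁₂ x y} (Ĝ-on-V₁₂ j)))

    D : Fin p → ℕ
    D j = count2 (λ x y → V₁₂ x y ∧ (Ĝ j x y xor G′ j x y))

    diffEdges-Ĝ-G′ : ∀ j → diffEdges (Ĝ j) (G′ j) ≡ D j
    diffEdges-Ĝ-G′ j = edgesOf≡count2 {V = V₁₂} {λ x y → Ĝ j x y xor G′ j x y} V₁₂-asym (λ x y → cong₂ _xor_ (Ĝ-sym j x y) (G′-sym j x y))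
                         (SupportedOn-xor {V = V₁₂} {Ĝ j} {G′ j} (SupportedOn-either {V = V₁₂} (λ x y → g x y == j)) (G′-supp j))

    ∑-edges-𝒢 : sumF (λ j → count2 (𝒢 j)) ≡ count2 V₁₂
    ∑-edges-𝒢 = sumF-count2-partition V₁₂ (λ j x y → g x y == j)
                  (λ x y i j gi gj → trans (sym (==-sound {a = g x y} gi)) (==-sound {a = g x y} gj))
                  (λ x y _ → anyF-intro (g x y ==_) (g x y) (==-refl (g x y)))

    ∑-q : sumF q ≡ count2 V₁₂
    ∑-q = sumF-count2-partition V₁₂ Ê (λ x y e e′ Êe Êe′ → disjoint e e′ x y Êe Êe′)
            (λ x y V₁₂xy → let e , Êxy = V₁₂-covered V₁₂xy in anyF-intro (λ e → Ê e x y) e Êxy)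

    -- C e bounds the contribution of the edges of e to the differences between the Ĝ j and G′ j.
    C : Fin m → ℕ
    C e = ∑∑ (λ x y → 𝟙 (Qset vp P e x y) ℕ.* mismatch (assign e) (g x y))

    pair-mismatch-V₁₂ : ∀ {x y e₀} → V₁₂ x y ≡ true → Ê e₀ x y ≡ true →
                        sumF (λ j → 𝟙 (V₁₂ x y ∧ (Ĝ j x y xor G′ j x y)))
                        ≡ sumF (λ e → 𝟙 (Qset vp P e x y) ℕ.* mismatch (assign e) (g x y))
    pair-mismatch-V₁₂ {x} {y} {e₀} V₁₂xy Êe₀ = begin
      sumF (λ j → 𝟙 (V₁₂ x y ∧ (Ĝ j x y xor G′ j x y)))
        ≡⟨ sumF-cong (λ j → cong 𝟙 (trans (cong (_∧ (Ĝ j x y xor G′ j x y)) V₁₂xy)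
                                          (cong₂ _xor_ (Ĝ-on-V₁₂ j V₁₂xy) (G′-on-Ê j Êe₀)))) ⟩
      mismatch (assign e₀) (g x y)
        ≡⟨ ℕ.*-identityˡ _ ⟨
      1 ℕ.* mismatch (assign e₀) (g x y)
        ≡⟨ cong (λ b → 𝟙 b ℕ.* mismatch (assign e₀) (g x y)) (trans (cong (_∧ Ê e₀ x y) V₁₂xy) Êe₀) ⟨
      𝟙 (Qset vp P e₀ x y) ℕ.* mismatch (assign e₀) (g x y)
        ≡⟨ sumF-single (λ e → 𝟙 (Qset vp P e x y) ℕ.* mismatch (assign e) (g x y)) e₀ others ⟨
      sumF (λ e → 𝟙 (Qset vp P e x y) ℕ.* mismatch (assign e) (g x y)) ∎
      where
      open ≡-Reasoning
      others : ∀ e → e ≢ e₀ → 𝟙 (Qset vp P e x y) ℕ.* mismatch (assign e) (g x y) ≡ 0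
      others e e≢e₀ = cong (λ b → 𝟙 b ℕ.* mismatch (assign e) (g x y))
        (trans (cong (V₁₂ x y ∧_) (Bool.¬-not (λ Êe → e≢e₀ (disjoint e e₀ x y Êe Êe₀)))) (Bool.∧-zeroʳ (V₁₂ x y)))

    pair-mismatch : ∀ x y → sumF (λ j → 𝟙 (V₁₂ x y ∧ (Ĝ j x y xor G′ j x y)))
                            ≡ sumF (λ e → 𝟙 (Qset vp P e x y) ℕ.* mismatch (assign e) (g x y))
    pair-mismatch x y = by-cases (V₁₂ x y Bool.≟ true)
      where
      by-cases : Dec (V₁₂ x y ≡ true) → sumF (λ j → 𝟙 (V₁₂ x y ∧ (Ĝ j x y xor G′ j x y)))
                                        ≡ sumF (λ e → 𝟙 (Qset vp P e x y) ℕ.* mismatch (assign e) (g x y))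
      by-cases (yes V₁₂xy) = pair-mismatch-V₁₂ V₁₂xy (proj₂ (V₁₂-covered V₁₂xy))
      by-cases (no ¬V₁₂xy) = trans (sumF-zero (λ j → cong (λ b → 𝟙 (b ∧ (Ĝ j x y xor G′ j x y))) V₁₂xy≡false))
        (sym (sumF-zero (λ e → cong (λ b → 𝟙 (b ∧ Ê e x y) ℕ.* mismatch (assign e) (g x y)) V₁₂xy≡false)))
        where V₁₂xy≡false = Bool.¬-not ¬V₁₂xy

    ∑D≡∑C : sumF D ≡ sumF C
    ∑D≡∑C = trans (sumF-∑∑ (λ j x y → 𝟙 (V₁₂ x y ∧ (Ĝ j x y xor G′ j x y))))
              (trans (∑∑-cong pair-mismatch)
                     (sym (sumF-∑∑ (λ e x y → 𝟙 (Qset vp P e x y) ℕ.* mismatch (assign e) (g x y)))))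

    bad : Fin m → ℕ
    bad e = if isE₃ vp P e ∧ not (inβ vp P 𝒢 δ e) then q e else 0

    C-unassigned : ∀ e → assign e ≡ nothing → C e ≡ q e
    C-unassigned e unassigned = ∑∑-cong λ x y → begin
      𝟙 (Qset vp P e x y) ℕ.* mismatch (assign e) (g x y) ≡⟨ cong (λ r → 𝟙 (Qset vp P e x y) ℕ.* mismatch r (g x y)) unassigned ⟩
      𝟙 (Qset vp P e x y) ℕ.* mismatch nothing (g x y)    ≡⟨ cong (𝟙 (Qset vp P e x y) ℕ.*_) (mismatch-nothing (g x y)) ⟩
      𝟙 (Qset vp P e x y) ℕ.* 1                           ≡⟨ ℕ.*-identityʳ _ ⟩
      𝟙 (Qset vp P e x y)                                 ∎
      where open ≡-Reasoning

    C-assigned : ∀ e {i} → assign e ≡ just i → C e ℕ.≤ out e i ℕ.+ out e i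
    C-assigned e {i} assigned = ℕ.≤-trans
      (∑∑-mono (λ x y → 𝟙-*-mismatch-bound (Qset vp P e x y) (V₁₂ x y) (g x y == i) (proj₁ ∘ ∧-true)
        (subst (λ r → mismatch r (g x y) ℕ.≤ _) (sym assigned) (mismatch-just i (g x y)))))
      (ℕ.≤-reflexive (∑∑-distrib-+ (λ x y → 𝟙 (Qset vp P e x y ∧ not (𝒢 i x y)))
                                   (λ x y → 𝟙 (Qset vp P e x y ∧ not (𝒢 i x y)))))

    q≤bad : ∀ e → assign e ≡ nothing → q e ℕ.≤ bad e
    q≤bad e unassigned = by-cases (0 ℕ.<? q e)
      where
      by-cases : Dec (0 ℕ.< q e) → q e ℕ.≤ bad e
      by-cases (no  q≯0) = subst (ℕ._≤ bad e) (sym (ℕ.n≤0⇒n≡0 (ℕ.≮⇒≥ q≯0))) z≤n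
      by-cases (yes q>0) = ℕ.≤-reflexive (sym (cong (λ b → if b then q e else 0)
                             (cong₂ _∧_ e∈ℰ₃ (cong not (findF-nothing (fits e) unassigned)))))
        where
        e∈ℰ₃ : isE₃ vp P e ≡ true
        e∈ℰ₃ = let x₀ , y₀ , V₁₂x₀y₀ , Êx₀y₀ = count2-pos-elim-∧ V₁₂ (Ê e) q>0 in Ê-meets-V₁₂⇒∈ℰ₃ e V₁₂x₀y₀ Êx₀y₀

    bad-assigned : ∀ e {i} → assign e ≡ just i → bad e ≡ 0
    bad-assigned e {i} assigned = cong (λ b → if b then q e else 0)
      (trans (cong (λ b → isE₃ vp P e ∧ not b) (anyF-intro (fits e) i (findF-just (fits e) assigned)))
             (Bool.∧-zeroʳ (isE₃ vp P e)))

    cost-bound : 0ℚ ≤ δ → ∀ e → ⟦ C e ⟧ ≤ ⟦ bad e ⟧ + (δ * ⟦ q e ⟧ + δ * ⟦ q e ⟧)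
    cost-bound 0≤δ e = by-cases (assign e) refl
      where
      δq≥0 : 0ℚ ≤ δ * ⟦ q e ⟧
      δq≥0 = *-nonNeg 0≤δ (⟦⟧-nonNeg (q e))
      by-cases : ∀ r → assign e ≡ r → ⟦ C e ⟧ ≤ ⟦ bad e ⟧ + (δ * ⟦ q e ⟧ + δ * ⟦ q e ⟧)
      by-cases nothing unassigned = ≤-+-nonNeg
        (⟦⟧-mono-≤ (subst (ℕ._≤ bad e) (sym (C-unassigned e unassigned)) (q≤bad e unassigned)))
        (ℚ.+-mono-≤ δq≥0 δq≥0)
      by-cases (just i) assigned = begin
        ⟦ C e ⟧                                  ≤⟨ ⟦⟧-mono-≤ (C-assigned e assigned) ⟩
        ⟦ out e i ℕ.+ out e i ⟧                  ≡⟨ ⟦⟧-+ (out e i) (out e i) ⟩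
        ⟦ out e i ⟧ + ⟦ out e i ⟧                ≤⟨ ℚ.+-mono-≤ (ℚ.<⇒≤ fits-ei) (ℚ.<⇒≤ fits-ei) ⟩
        δ * ⟦ q e ⟧ + δ * ⟦ q e ⟧                ≡⟨ ℚ.+-identityˡ _ ⟨
        0ℚ + (δ * ⟦ q e ⟧ + δ * ⟦ q e ⟧)         ≡⟨ cong (λ b → ⟦ b ⟧ + (δ * ⟦ q e ⟧ + δ * ⟦ q e ⟧)) (bad-assigned e assigned) ⟨
        ⟦ bad e ⟧ + (δ * ⟦ q e ⟧ + δ * ⟦ q e ⟧)  ∎
        where
        open ℚ.≤-Reasoning
        fits-ei : ⟦ out e i ⟧ < δ * ⟦ q e ⟧
        fits-ei = fits-sound e i (findF-just (fits e) assigned)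

    total-cost : 0ℚ ≤ δ → RefinesApprox vp P 𝒢 δ → ⟦ sumF C ⟧ ≤ ⟦ 3 ⟧ * δ * ⟦ count2 V₁₂ ⟧
    total-cost 0≤δ approx = begin
      ⟦ sumF C ⟧                                                ≡⟨ ⟦sumF⟧ C ⟩
      ℚΣ.sum (⟦_⟧ ∘ C)                                          ≤⟨ sum-mono-≤ (cost-bound 0≤δ) ⟩
      ℚΣ.sum (λ e → ⟦ bad e ⟧ + (δ * ⟦ q e ⟧ + δ * ⟦ q e ⟧))   ≡⟨ split ⟩
      ⟦ sumF bad ⟧ + (δ * ⟦ N ⟧ + δ * ⟦ N ⟧)                    ≤⟨ ℚ.+-monoˡ-≤ (δ * ⟦ N ⟧ + δ * ⟦ N ⟧) approx ⟩
      δ * ⟦ N ⟧ + (δ * ⟦ N ⟧ + δ * ⟦ N ⟧)                       ≡⟨ ⟦3⟧*-expand δ ⟦ N ⟧ ⟨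
      ⟦ 3 ⟧ * δ * ⟦ N ⟧                                         ∎
      where
      open ℚ.≤-Reasoning
      N : ℕ
      N = count2 V₁₂
      δ∑q : ℚΣ.sum (λ e → δ * ⟦ q e ⟧) ≡ δ * ⟦ N ⟧
      δ∑q = trans (sym (ℚΣ.*-distribˡ-sum δ (⟦_⟧ ∘ q))) (cong (δ *_) (trans (sym (⟦sumF⟧ q)) (cong ⟦_⟧ ∑-q)))
      split : ℚΣ.sum (λ e → ⟦ bad e ⟧ + (δ * ⟦ q e ⟧ + δ * ⟦ q e ⟧)) ≡ ⟦ sumF bad ⟧ + (δ * ⟦ N ⟧ + δ * ⟦ N ⟧)
      split = trans (ℚΣ.∑-distrib-+ (⟦_⟧ ∘ bad) (λ e → δ * ⟦ q e ⟧ + δ * ⟦ q e ⟧))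
                (cong₂ _+_ (sym (⟦sumF⟧ bad))
                  (trans (ℚΣ.∑-distrib-+ (λ e → δ * ⟦ q e ⟧) (λ e → δ * ⟦ q e ⟧)) (cong₂ _+_ δ∑q δ∑q)))

    ∃-class-with-few-changes : Fin p → 0ℚ ≤ δ → RefinesApprox vp P 𝒢 δ →
                               ∃ λ j → ⟦ D j ⟧ ≤ ⟦ 3 ⟧ * δ * ⟦ count2 (𝒢 j) ⟧
    ∃-class-with-few-changes j₀ 0≤δ approx =
      sum-≤⇒∃-≤ (⟦_⟧ ∘ D) (λ j → ⟦ 3 ⟧ * δ * ⟦ count2 (𝒢 j) ⟧) j₀ (begin
        ℚΣ.sum (⟦_⟧ ∘ D)                                    ≡⟨ ⟦sumF⟧ D ⟨
        ⟦ sumF D ⟧                                           ≡⟨ cong ⟦_⟧ ∑D≡∑C ⟩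
        ⟦ sumF C ⟧                                           ≤⟨ total-cost 0≤δ approx ⟩
        ⟦ 3 ⟧ * δ * ⟦ count2 V₁₂ ⟧                           ≡⟨ cong (⟦ 3 ⟧ * δ *_) (cong ⟦_⟧ ∑-edges-𝒢) ⟨
        ⟦ 3 ⟧ * δ * ⟦ sumF (λ j → count2 (𝒢 j)) ⟧           ≡⟨ cong (⟦ 3 ⟧ * δ *_) (⟦sumF⟧ (λ j → count2 (𝒢 j))) ⟩
        ⟦ 3 ⟧ * δ * ℚΣ.sum (λ j → ⟦ count2 (𝒢 j) ⟧)         ≡⟨ ℚΣ.*-distribˡ-sum (⟦ 3 ⟧ * δ) (λ j → ⟦ count2 (𝒢 j) ⟧) ⟩
        ℚΣ.sum (λ j → ⟦ 3 ⟧ * δ * ⟦ count2 (𝒢 j) ⟧)         ∎)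
      where open ℚ.≤-Reasoning

    regular-partition : Good δ → 0ℚ ≤ δ → ∀ j → ⟦ D j ⟧ ≤ ⟦ 3 ⟧ * δ * ⟦ count2 (𝒢 j) ⟧ →
                        RegularPartition (⟦ 3 ⟧ * δ) (λ x → not (vp x == v₃)) (Ĝ j) part
                                         (λ c → ∃ λ x → (Z x ≡ c) × (vp x ≢ v₃))
    regular-partition good 0≤δ j few-changes =
      G′ j , G′-sym j , (λ x y G′xy → V₁₂-outside-V₃ (G′-supp j x y G′xy)) ,
      subst₂ (λ d e → ⟦ d ⟧ ≤ ⟦ 3 ⟧ * δ * ⟦ e ⟧) (sym (diffEdges-Ĝ-G′ j)) (sym (edgesOf-Ĝ j)) few-changes ,
      λ c c′ _ _ _ → Regular-mono δ≤3δ (Regular-G′ good j c c′)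
      where
      δ≤3δ : δ ≤ ⟦ 3 ⟧ * δ
      δ≤3δ = subst (_≤ ⟦ 3 ⟧ * δ) (ℚ.*-identityˡ δ) (ℚ.*-monoʳ-≤-nonNeg δ {{ℚ.nonNegative 0≤δ}} 1≤⟦3⟧)

claim3 : ∀ {n : ℕ} (vp : Fin n → Fin 3) (P : TwoPartition n) (δ : ℚ) →
         (∃ λ x → vp x ≡ v₁) → (∃ λ y → vp y ≡ v₂) →
         Refines vp P →
         (p : ℕ) (g : Fin n → Fin n → Fin p) →
         (∀ j → ∃ λ x → ∃ λ y → (V₁×V₂ vp P x y ≡ true) × (g x y ≡ j)) →
         RefinesApprox vp P (λ j x y → V₁×V₂ vp P x y ∧ (g x y == j)) δ →
         TwoPartition.Good P δ →
         ∃ λ j → RegularPartition (⟦ 3 ⟧ * δ) (λ x → not (vp x == v₃))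
           (λ x y → (V₁×V₂ vp P x y ∧ (g x y == j)) ∨ (V₁×V₂ vp P y x ∧ (g y x == j)))
           (λ c x → TwoPartition.Z P x == c)
           (λ c → ∃ λ x → (TwoPartition.Z P x ≡ c) × (vp x ≢ v₃))
claim3 vp P δ (x₀ , x₀∈V₁) (y₀ , y₀∈V₂) refines p g _ approx good =
  let j , few-changes = ∃-class-with-few-changes g δ (g x₀ y₀) 0≤δ approx
  in j , regular-partition g δ good 0≤δ j few-changes
  where
  open Construction vp P refines
  V₁₂x₀y₀ : V₁₂ x₀ y₀ ≡ true
  V₁₂x₀y₀ = V₁₂-complete x₀∈V₁ y₀∈V₂
  0≤δ : 0ℚ ≤ δ
  0≤δ = nonNeg-of-≤-*-pos (⟦⟧-pos (count2-pos-intro V₁₂ V₁₂x₀y₀)) (⟦⟧-nonNeg (sumF (bad g δ))) approx
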